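{- Let $\mathbb{F}$ be a finite field with $|\mathbb{F}|=p^k>2$, where $p$ is a prime and $k$ a positive integer, and let $n\ge 2$. Then \[ C_{T_n(\mathbb{F})} \simeq K_m \bullet A(H(n,p^k)), \] where $m=p^{\frac{kn(n-1)}{2}}$.
   Context: For a finite ring $R$ with identity, the unitary Cayley graph $C_R$ is the simple graph with vertex set $R$ in which distinct $x,y\in R$ are adjacent if and only if $x-y$ is a unit of $R$. $T_n(\mathbb{F})$ denotes the ring of all upper triangular $n\times n$ matrices over $\mathbb{F}$. $K_m$ is the complete graph on $m$ vertices. The Hamming graph $H(n,p^k)$ has as vertices all $n$-tuples of elements of $\mathbb{F}$, two tuples being adjacent if they differ in exactly one coordinate. The antipodal graph $A(G)$ of a connected graph $G$ has the same vertex set as $G$, with $u,v$ adjacent iff $d_G(u,v)=\mathrm{diam}(G)$; thus $A(H(n,p^k))$ has vertex set $\mathbb{F}^n$ and $(u_1,\dots,u_n)$, $(v_1,\dots,v_n)$ are adjacent iff $u_i\ne v_i$ for every $1\le i\le n$. For simple graphs $G,H$, the semistrong product $G\bullet H$ has vertex set $V(G)\times V(H)$, and $(u_1,v_1)$ is adjacent to $(u_2,v_2)$ iff either ($u_1u_2\in E(G)$ and $v_1v_2\in E(H)$) or ($u_1=u_2$ and $v_1v_2\in E(H)$). -}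

module Defs where

open import Level using (Level; _⊔_) renaming (suc to lsuc)
open import Algebra.Bundles using (CommutativeRing)
open import Data.Nat using (ℕ; zero; suc; _<_)
open import Data.Fin using (Fin; toℕ) renaming (zero to fzero; suc to fsuc)
import Data.Fin as Fin
open import Data.Product using (Σ; ∃; _×_; _,_; proj₁; proj₂)
open import Data.Product.Relation.Binary.Pointwise.NonDependent using (×-setoid)
open import Data.Sum using (_⊎_)
open import Relation.Nullary using (¬_; yes; no)
open import Relation.Binary using (Setoid)
open import Relation.Binary.PropositionalEquality as ≡ using (_≡_)
open import Function using (_∘_)
open import Function.Bundles using (Inverse; _⇔_)

record Field (c ℓ : Level) : Set (lsuc (c ⊔ ℓ)) where
  field
    commRing : CommutativeRing c ℓ
  open CommutativeRing commRing public
  field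
    1≉0     : ¬ (1# ≈ 0#)
    inverse : ∀ x → ¬ (x ≈ 0#) → ∃ λ y → (x * y) ≈ 1#

HasCardinality : ∀ {c ℓ} → Field c ℓ → ℕ → Set (c ⊔ ℓ)
HasCardinality F q = Inverse (Field.setoid F) (≡.setoid (Fin q))

record Graph (c ℓ e : Level) : Set (lsuc (c ⊔ ℓ ⊔ e)) where
  field
    V   : Setoid c ℓ
    Adj : Setoid.Carrier V → Setoid.Carrier V → Set e

open Graph public

_≃_ : ∀ {c₁ ℓ₁ e₁ c₂ ℓ₂ e₂} → Graph c₁ ℓ₁ e₁ → Graph c₂ ℓ₂ e₂ →
      Set (c₁ ⊔ ℓ₁ ⊔ e₁ ⊔ c₂ ⊔ ℓ₂ ⊔ e₂)
G ≃ H = Σ (Inverse (V G) (V H)) λ f →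
          ∀ x y → Adj G x y ⇔ Adj H (Inverse.to f x) (Inverse.to f y)

K : ℕ → Graph _ _ _
K m = record { V = ≡.setoid (Fin m) ; Adj = λ x y → ¬ (x ≡ y) }

_•_ : ∀ {c₁ ℓ₁ e₁ c₂ ℓ₂ e₂} → Graph c₁ ℓ₁ e₁ → Graph c₂ ℓ₂ e₂ →
      Graph (c₁ ⊔ c₂) (ℓ₁ ⊔ ℓ₂) (ℓ₁ ⊔ e₁ ⊔ e₂)
G • H = record
  { V   = ×-setoid (V G) (V H)
  ; Adj = λ { (u₁ , v₁) (u₂ , v₂) →
              (Adj G u₁ u₂ × Adj H v₁ v₂) ⊎ (Setoid._≈_ (V G) u₁ u₂ × Adj H v₁ v₂) }
  }

module _ {c ℓ} (F : Field c ℓ) where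
  open Field F

  vecSetoid : ℕ → Setoid c ℓ
  vecSetoid n = record
    { Carrier       = Fin n → Carrier
    ; _≈_           = λ u v → ∀ i → u i ≈ v i
    ; isEquivalence = record
      { refl  = λ i → refl
      ; sym   = λ p i → sym (p i)
      ; trans = λ p q i → trans (p i) (q i) } }

  AntipodalHamming : ℕ → Graph c ℓ ℓ
  AntipodalHamming n = record
    { V   = vecSetoid n
    ; Adj = λ u v → ∀ i → ¬ (u i ≈ v i) }

  Mat : ℕ → Set c
  Mat n = Fin n → Fin n → Carrier

  ∑ : ∀ n → (Fin n → Carrier) → Carrier
  ∑ zero    f = 0#
  ∑ (suc n) f = f fzero + ∑ n (f ∘ fsuc)

  _⊗_ : ∀ {n} → Mat n → Mat n → Mat n
  (A ⊗ B) i j = ∑ _ (λ l → A i l * B l j)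

  _⊖_ : ∀ {n} → Mat n → Mat n → Mat n
  (A ⊖ B) i j = A i j - B i j

  Id : ∀ {n} → Mat n
  Id i j with i Fin.≟ j
  ... | yes _ = 1#
  ... | no  _ = 0#

  _≋_ : ∀ {n} → Mat n → Mat n → Set ℓ
  A ≋ B = ∀ i j → A i j ≈ B i j

  IsUpperTriangular : ∀ {n} → Mat n → Set ℓ
  IsUpperTriangular A = ∀ i j → toℕ j < toℕ i → A i j ≈ 0#

  T : ℕ → Set (c ⊔ ℓ)
  T n = Σ (Mat n) IsUpperTriangular

  TSetoid : ℕ → Setoid (c ⊔ ℓ) ℓ
  TSetoid n = record
    { Carrier       = T n
    ; _≈_           = λ A B → proj₁ A ≋ proj₁ B
    ; isEquivalence = record
      { refl  = λ i j → refl
      ; sym   = λ p i j → sym (p i j)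
      ; trans = λ p q i j → trans (p i j) (q i j) } }

  IsUnitT : ∀ {n} → T n → Set (c ⊔ ℓ)
  IsUnitT {n} A = Σ (T n) λ B →
    ((proj₁ A ⊗ proj₁ B) ≋ Id) × ((proj₁ B ⊗ proj₁ A) ≋ Id)

  _⊖T_ : ∀ {n} → T n → T n → T n
  A ⊖T B = (proj₁ A ⊖ proj₁ B) , λ i j j<i →
    trans (-‿cong₂ (proj₂ A i j j<i) (proj₂ B i j j<i)) (-‿inverseʳ 0#)
    where
      -‿cong₂ : ∀ {a b a' b'} → a ≈ a' → b ≈ b' → (a - b) ≈ (a' - b')
      -‿cong₂ p q = +-cong p (-‿cong q)

  UnitaryCayleyT : ℕ → Graph (c ⊔ ℓ) ℓ (c ⊔ ℓ)
  UnitaryCayleyT n = record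
    { V   = TSetoid n
    ; Adj = λ x y → ¬ (Setoid._≈_ (TSetoid n) x y) × IsUnitT (x ⊖T y) }

{-# OPTIONS --safe #-}
module Submission where

-- An upper triangular matrix is a unit of T_n(F) iff its diagonal entries are all
-- nonzero: the diagonal of a product is the product of the diagonals, and conversely
-- writing A = [a r; 0 A′] an inverse is built from a⁻¹ and, inductively, A′⁻¹. Hence
-- x and y are adjacent in C_{T_n(F)} iff their diagonals differ in every coordinate,
-- i.e. iff the diagonals are adjacent in A(H(n,q)); for n ≥ 1 this already forces
-- x ≠ y. Splitting a matrix into its n C 2 strictly upper entries and its diagonal
-- identifies T_n(F) with Fin (q ^ (n C 2)) × Fⁿ, and since (u , v) ~ (u′ , v′) in
-- K_m • G exactly when v ~ v′ in G, this bijection is the required isomorphism.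

open import Defs
open import Data.Nat using (ℕ; zero; suc; s≤s; z≤n)
open import Data.Fin using (Fin) renaming (zero to fzero; suc to fsuc)
import Data.Fin as Fin
open import Data.Product using (∃; _,_; proj₁; proj₂)
open import Data.Sum using (inj₁; inj₂)
open import Relation.Nullary using (¬_; Dec; yes; no)
open import Relation.Binary using (Setoid)
open import Relation.Binary.PropositionalEquality as ≡ using (_≡_)
open import Function using (_∘_)
open import Function.Bundles using (Inverse; _⇔_; mk⇔)
open import Function.Definitions using (Congruent; StrictlyInverseˡ; StrictlyInverseʳ)
open import Data.Product.Relation.Binary.Pointwise.NonDependent using (_×ₛ_; Pointwise-≡↔≡)
open import Data.Product.Function.NonDependent.Setoid using (_×-inverse_)
open import Data.Vec.Functional using (_∷_)
open import Function.Construct.Composition using (_⇔-∘_)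
import Function.Construct.Composition as Composition
import Function.Construct.Identity as Identity
import Function.Construct.Symmetry as Symmetry

module _ {c ℓ} (F : Field c ℓ) where
  open Field F
  open import Algebra.Properties.Semiring.Sum semiring
    using (sum; sum-cong-≋; sum-replicate-zero; ∑-comm; *-distribˡ-sum; *-distribʳ-sum)
  open import Algebra.Properties.Ring ring using (-‿distribˡ-*; -‿distribʳ-*)
  open import Algebra.Properties.Group +-group using (x∙y⁻¹≈ε⇒x≈y; x≈y⇒x∙y⁻¹≈ε)
  open import Relation.Binary.Reasoning.Setoid setoid

  ∑≡sum : ∀ n (f : Fin n → Carrier) → ∑ F n f ≡ sum f
  ∑≡sum zero    f = ≡.refl
  ∑≡sum (suc n) f = ≡.cong (f fzero +_) (∑≡sum n (f ∘ fsuc))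

  ∑-cong : ∀ n {f g : Fin n → Carrier} → (∀ i → f i ≈ g i) → ∑ F n f ≈ ∑ F n g
  ∑-cong n {f} {g} f≈g rewrite ∑≡sum n f | ∑≡sum n g = sum-cong-≋ f≈g

  ∑-zero : ∀ n {f : Fin n → Carrier} → (∀ i → f i ≈ 0#) → ∑ F n f ≈ 0#
  ∑-zero n {f} f≈0 rewrite ∑≡sum n f = trans (sum-cong-≋ f≈0) (sum-replicate-zero n)

  *-distribˡ-∑ : ∀ n x (f : Fin n → Carrier) → x * ∑ F n f ≈ ∑ F n (λ i → x * f i)
  *-distribˡ-∑ n x f rewrite ∑≡sum n f | ∑≡sum n (λ i → x * f i) = *-distribˡ-sum x f

  *-distribʳ-∑ : ∀ n x (f : Fin n → Carrier) → ∑ F n f * x ≈ ∑ F n (λ i → f i * x)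
  *-distribʳ-∑ n x f rewrite ∑≡sum n f | ∑≡sum n (λ i → f i * x) = *-distribʳ-sum x f

  ∑-swap : ∀ m n (f : Fin m → Fin n → Carrier) →
           ∑ F m (λ i → ∑ F n (f i)) ≈ ∑ F n (λ j → ∑ F m (λ i → f i j))
  ∑-swap m n f = begin
    ∑ F m (λ i → ∑ F n (f i))            ≈⟨ ∑-cong m (λ i → reflexive (∑≡sum n (f i))) ⟩
    ∑ F m (λ i → sum (f i))              ≡⟨ ∑≡sum m _ ⟩
    sum (λ i → sum (f i))                ≈⟨ ∑-comm f ⟩
    sum (λ j → sum (λ i → f i j))        ≡⟨ ∑≡sum n _ ⟨
    ∑ F n (λ j → sum (λ i → f i j))      ≈⟨ ∑-cong n (λ j → reflexive (∑≡sum m (λ i → f i j))) ⟨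
    ∑ F n (λ j → ∑ F m (λ i → f i j))    ∎

  Id-suc : ∀ {n} (i j : Fin n) → Id F (fsuc i) (fsuc j) ≈ Id F i j
  Id-suc i j with i Fin.≟ j
  ... | yes _ = refl
  ... | no  _ = refl

  Id-diagonal : ∀ {n} (i : Fin n) → Id F i i ≈ 1#
  Id-diagonal fzero    = refl
  Id-diagonal (fsuc i) = trans (Id-suc i i) (Id-diagonal i)

  infixl 7 _ᵛ⊗_
  _ᵛ⊗_ : ∀ {n} → (Fin n → Carrier) → Mat F n → Fin n → Carrier
  _ᵛ⊗_ {n} r A j = ∑ F n (λ l → r l * A l j)

  ᵛ⊗-congˡ : ∀ {n} (r : Fin n → Carrier) {A B : Mat F n} → _≋_ F A B → ∀ j → (r ᵛ⊗ A) j ≈ (r ᵛ⊗ B) j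
  ᵛ⊗-congˡ {n} r A≋B j = ∑-cong n (λ l → *-congˡ (A≋B l j))

  ᵛ⊗-identityʳ : ∀ {n} (r : Fin n → Carrier) j → (r ᵛ⊗ Id F) j ≈ r j
  ᵛ⊗-identityʳ {suc n} r fzero = begin
    r fzero * 1# + ∑ F n (λ l → r (fsuc l) * 0#)  ≈⟨ +-cong (*-identityʳ _) (∑-zero n (λ l → zeroʳ _)) ⟩
    r fzero + 0#                                  ≈⟨ +-identityʳ _ ⟩
    r fzero                                       ∎
  ᵛ⊗-identityʳ {suc n} r (fsuc j) = begin
    r fzero * 0# + ∑ F n (λ l → r (fsuc l) * Id F (fsuc l) (fsuc j))
      ≈⟨ +-cong (zeroʳ _) (∑-cong n (λ l → *-congˡ (Id-suc l j))) ⟩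
    0# + (r ∘ fsuc ᵛ⊗ Id F) j                     ≈⟨ +-identityˡ _ ⟩
    (r ∘ fsuc ᵛ⊗ Id F) j                          ≈⟨ ᵛ⊗-identityʳ (r ∘ fsuc) j ⟩
    r (fsuc j)                                    ∎

  ᵛ⊗-assoc : ∀ {n} (r : Fin n → Carrier) (B A : Mat F n) j → (r ᵛ⊗ B ᵛ⊗ A) j ≈ (r ᵛ⊗ _⊗_ F B A) j
  ᵛ⊗-assoc {n} r B A j = begin
    ∑ F n (λ l → ∑ F n (λ m → r m * B m l) * A l j)    ≈⟨ ∑-cong n (λ l → *-distribʳ-∑ n (A l j) _) ⟩
    ∑ F n (λ l → ∑ F n (λ m → r m * B m l * A l j))    ≈⟨ ∑-cong n (λ l → ∑-cong n (λ m → *-assoc _ _ _)) ⟩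
    ∑ F n (λ l → ∑ F n (λ m → r m * (B m l * A l j)))  ≈⟨ ∑-swap n n _ ⟩
    ∑ F n (λ m → ∑ F n (λ l → r m * (B m l * A l j)))  ≈⟨ ∑-cong n (λ m → *-distribˡ-∑ n (r m) _) ⟨
    ∑ F n (λ m → r m * ∑ F n (λ l → B m l * A l j))    ∎

  ᵛ⊗-scaleˡ : ∀ {n} x (r : Fin n → Carrier) (A : Mat F n) j → ((λ l → x * r l) ᵛ⊗ A) j ≈ x * (r ᵛ⊗ A) j
  ᵛ⊗-scaleˡ {n} x r A j = trans (∑-cong n (λ l → *-assoc x (r l) (A l j))) (sym (*-distribˡ-∑ n x _))

  sub : ∀ {n} → Mat F (suc n) → Mat F n
  sub A i j = A (fsuc i) (fsuc j)

  row : ∀ {n} → Mat F (suc n) → Fin n → Carrier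
  row A j = A fzero (fsuc j)

  block : ∀ {n} → Carrier → (Fin n → Carrier) → Mat F n → Mat F (suc n)
  block a r A fzero    fzero    = a
  block a r A fzero    (fsuc j) = r j
  block a r A (fsuc i) fzero    = 0#
  block a r A (fsuc i) (fsuc j) = A i j

  sub-upper : ∀ {n} {A : Mat F (suc n)} → IsUpperTriangular F A → IsUpperTriangular F (sub A)
  sub-upper A-upper i j j<i = A-upper (fsuc i) (fsuc j) (s≤s j<i)

  block-upper : ∀ {n} a r {A : Mat F n} → IsUpperTriangular F A → IsUpperTriangular F (block a r A)
  block-upper a r A-upper (fsuc i) fzero    _         = refl
  block-upper a r A-upper (fsuc i) (fsuc j) (s≤s j<i) = A-upper i j j<i

  module _ {n} (A B : Mat F (suc n)) where

    ⊗-head : IsUpperTriangular F B → _⊗_ F A B fzero fzero ≈ A fzero fzero * B fzero fzero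
    ⊗-head B-upper = trans (+-congˡ (∑-zero n (λ l → trans (*-congˡ (B-upper (fsuc l) fzero (s≤s z≤n))) (zeroʳ _))))
                           (+-identityʳ _)

    ⊗-lower : IsUpperTriangular F A → IsUpperTriangular F B → ∀ i → _⊗_ F A B (fsuc i) fzero ≈ 0#
    ⊗-lower A-upper B-upper i = begin
      A (fsuc i) fzero * B fzero fzero + ∑ F n (λ l → A (fsuc i) (fsuc l) * B (fsuc l) fzero)
        ≈⟨ +-cong (trans (*-congʳ (A-upper (fsuc i) fzero (s≤s z≤n))) (zeroˡ _))
                  (∑-zero n (λ l → trans (*-congˡ (B-upper (fsuc l) fzero (s≤s z≤n))) (zeroʳ _))) ⟩
      0# + 0#  ≈⟨ +-identityˡ 0# ⟩
      0#       ∎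

    ⊗-sub : IsUpperTriangular F A → ∀ i j → _⊗_ F A B (fsuc i) (fsuc j) ≈ _⊗_ F (sub A) (sub B) i j
    ⊗-sub A-upper i j = trans (+-congʳ (trans (*-congʳ (A-upper (fsuc i) fzero (s≤s z≤n))) (zeroˡ _)))
                              (+-identityˡ _)

  ⊗-diagonal : ∀ {n} (A B : Mat F n) → IsUpperTriangular F A → IsUpperTriangular F B →
               ∀ i → _⊗_ F A B i i ≈ A i i * B i i
  ⊗-diagonal A B A-upper B-upper fzero    = ⊗-head A B B-upper
  ⊗-diagonal A B A-upper B-upper (fsuc i) =
    trans (⊗-sub A B A-upper i i) (⊗-diagonal (sub A) (sub B) (sub-upper A-upper) (sub-upper B-upper) i)

  diagonal : ∀ {n} → T F n → Fin n → Carrier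
  diagonal A i = proj₁ A i i

  unit⇒diagonal≉0 : ∀ {n} (A : T F n) → IsUnitT F A → ∀ i → ¬ (diagonal A i ≈ 0#)
  unit⇒diagonal≉0 (A , A-upper) ((B , B-upper) , A⊗B≋I , _) i Aᵢᵢ≈0 = 1≉0 (begin
    1#              ≈⟨ Id-diagonal i ⟨
    Id F i i        ≈⟨ A⊗B≋I i i ⟨
    _⊗_ F A B i i   ≈⟨ ⊗-diagonal A B A-upper B-upper i ⟩
    A i i * B i i   ≈⟨ *-congʳ Aᵢᵢ≈0 ⟩
    0# * B i i      ≈⟨ zeroˡ _ ⟩
    0#              ∎)

  -- The inverse of [a r; 0 A′] is [b s; 0 B′] with b = a⁻¹, B′ = A′⁻¹ and s = - b (r B′).
  corner-and-sub-unit⇒unit : ∀ {n} (A : Mat F (suc n)) (A-upper : IsUpperTriangular F A) →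
    (∃ λ b → A fzero fzero * b ≈ 1#) → IsUnitT F (sub A , sub-upper A-upper) → IsUnitT F (A , A-upper)
  corner-and-sub-unit⇒unit {n} A A-upper (b , ab≈1) ((B′ , B′-upper) , A′⊗B′≋I , B′⊗A′≋I) =
    (B , B-upper) , A⊗B≋I , B⊗A≋I
    where
      a : Carrier
      a = A fzero fzero

      R s : Fin n → Carrier
      R = row A ᵛ⊗ B′
      s j = - b * R j

      B : Mat F (suc n)
      B = block b s B′

      B-upper : IsUpperTriangular F B
      B-upper = block-upper b s B′-upper

      as≈-R : ∀ j → a * s j ≈ - R j
      as≈-R j = begin
        a * (- b * R j)    ≈⟨ *-assoc a (- b) (R j) ⟨
        a * - b * R j      ≈⟨ *-congʳ (-‿distribʳ-* a b) ⟨
        - (a * b) * R j    ≈⟨ *-congʳ (-‿cong ab≈1) ⟩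
        - 1# * R j         ≈⟨ -‿distribˡ-* 1# (R j) ⟨
        - (1# * R j)       ≈⟨ -‿cong (*-identityˡ (R j)) ⟩
        - R j              ∎

      sA′≈-br : ∀ j → (s ᵛ⊗ sub A) j ≈ - (b * row A j)
      sA′≈-br j = begin
        (s ᵛ⊗ sub A) j                       ≈⟨ ᵛ⊗-scaleˡ (- b) R (sub A) j ⟩
        - b * (R ᵛ⊗ sub A) j                 ≈⟨ *-congˡ (ᵛ⊗-assoc (row A) B′ (sub A) j) ⟩
        - b * (row A ᵛ⊗ _⊗_ F B′ (sub A)) j  ≈⟨ *-congˡ (ᵛ⊗-congˡ (row A) B′⊗A′≋I j) ⟩
        - b * (row A ᵛ⊗ Id F) j              ≈⟨ *-congˡ (ᵛ⊗-identityʳ (row A) j) ⟩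
        - b * row A j                        ≈⟨ -‿distribˡ-* b (row A j) ⟨
        - (b * row A j)                      ∎

      A⊗B≋I : _≋_ F (_⊗_ F A B) (Id F)
      A⊗B≋I fzero    fzero    = trans (⊗-head A B B-upper) ab≈1
      A⊗B≋I fzero    (fsuc j) = trans (+-congʳ (as≈-R j)) (-‿inverseˡ (R j))
      A⊗B≋I (fsuc i) fzero    = ⊗-lower A B A-upper B-upper i
      A⊗B≋I (fsuc i) (fsuc j) = trans (⊗-sub A B A-upper i j) (trans (A′⊗B′≋I i j) (sym (Id-suc i j)))

      B⊗A≋I : _≋_ F (_⊗_ F B A) (Id F)
      B⊗A≋I fzero    fzero    = trans (⊗-head B A A-upper) (trans (*-comm b a) ab≈1)
      B⊗A≋I fzero    (fsuc j) = trans (+-congˡ (sA′≈-br j)) (-‿inverseʳ (b * row A j))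
      B⊗A≋I (fsuc i) fzero    = ⊗-lower B A B-upper A-upper i
      B⊗A≋I (fsuc i) (fsuc j) = trans (⊗-sub B A B-upper i j) (trans (B′⊗A′≋I i j) (sym (Id-suc i j)))

  diagonal≉0⇒unit : ∀ {n} (A : T F n) → (∀ i → ¬ (diagonal A i ≈ 0#)) → IsUnitT F A
  diagonal≉0⇒unit {zero}  _ _ = ((λ ()) , λ ()) , (λ ()) , (λ ())
  diagonal≉0⇒unit {suc n} (A , A-upper) A≉0 =
    corner-and-sub-unit⇒unit A A-upper (inverse (A fzero fzero) (A≉0 fzero))
      (diagonal≉0⇒unit (sub A , sub-upper A-upper) (A≉0 ∘ fsuc))

  UnitaryCayleyT-Adj⇔ : ∀ {n} (x y : T F (suc n)) →
    Adj (UnitaryCayleyT F (suc n)) x y ⇔ Adj (AntipodalHamming F (suc n)) (diagonal x) (diagonal y)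
  UnitaryCayleyT-Adj⇔ x y = mk⇔
    (λ (_ , x-y-unit) i xᵢᵢ≈yᵢᵢ → unit⇒diagonal≉0 (_⊖T_ F x y) x-y-unit i (x≈y⇒x∙y⁻¹≈ε xᵢᵢ≈yᵢᵢ))
    (λ apart → (λ x≈y → apart fzero (x≈y fzero fzero)) ,
               diagonal≉0⇒unit (_⊖T_ F x y) (λ i xᵢᵢ-yᵢᵢ≈0 → apart i (x∙y⁻¹≈ε⇒x≈y _ _ xᵢᵢ-yᵢᵢ≈0)))

-- Opened only here, since the field development above uses the field's _*_.
open import Data.Nat using (_+_; _≤_; _<_; _*_; _^_; _∸_; _/_)
open import Data.Nat.Properties using (*-comm; *-assoc; *-distribˡ-+; *-distribʳ-+; ^-distribˡ-+-*; ^-*-assoc)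
open import Data.Nat.DivMod using (m*n/n≡m)
open import Data.Nat.Primality using (Prime)
open import Data.Nat.Combinatorics using (_C_; nC1≡n; nCk+nC[k+1]≡[n+1]C[k+1])
open import Data.Fin.Properties using (*↔×)

module _ {a b ℓ₁ ℓ₂} {A : Setoid a ℓ₁} {B : Setoid b ℓ₂} where
  open Setoid A using () renaming (_≈_ to _≈₁_)
  open Setoid B using () renaming (_≈_ to _≈₂_)
  open import Function.Consequences.Setoid A B using (strictlyInverseˡ⇒inverseˡ; strictlyInverseʳ⇒inverseʳ)

  mkInverse : (to : Setoid.Carrier A → Setoid.Carrier B) (from : Setoid.Carrier B → Setoid.Carrier A) →
              Congruent _≈₁_ _≈₂_ to → Congruent _≈₂_ _≈₁_ from →
              StrictlyInverseˡ _≈₂_ to from → StrictlyInverseʳ _≈₁_ to from → Inverse A B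
  mkInverse to from to-cong from-cong to∘from from∘to = record
    { to        = to
    ; from      = from
    ; to-cong   = to-cong
    ; from-cong = from-cong
    ; inverse   = strictlyInverseˡ⇒inverseˡ to-cong to∘from , strictlyInverseʳ⇒inverseʳ from-cong from∘to
    }

infixr 1 _⨾_
_⨾_ : ∀ {a b c ℓ₁ ℓ₂ ℓ₃} {A : Setoid a ℓ₁} {B : Setoid b ℓ₂} {C : Setoid c ℓ₃} →
      Inverse A B → Inverse B C → Inverse A C
_⨾_ = Composition.inverse

×-shuffle : ∀ {a b c d ℓ₁ ℓ₂ ℓ₃ ℓ₄} {A : Setoid a ℓ₁} {B : Setoid b ℓ₂} {C : Setoid c ℓ₃} {D : Setoid d ℓ₄} →
            Inverse (A ×ₛ (B ×ₛ (C ×ₛ D))) ((B ×ₛ C) ×ₛ (A ×ₛ D))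
×-shuffle {A = A} {B} {C} {D} = mkInverse
  (λ (x , y , z , w) → (y , z) , (x , w))
  (λ ((y , z) , (x , w)) → x , y , z , w)
  (λ (x≈ , y≈ , z≈ , w≈) → (y≈ , z≈) , (x≈ , w≈))
  (λ ((y≈ , z≈) , (x≈ , w≈)) → x≈ , y≈ , z≈ , w≈)
  (λ _ → (Setoid.refl B , Setoid.refl C) , (Setoid.refl A , Setoid.refl D))
  (λ _ → Setoid.refl A , Setoid.refl B , Setoid.refl C , Setoid.refl D)

Fin-cast : ∀ {m n} → m ≡ n → Inverse (≡.setoid (Fin m)) (≡.setoid (Fin n))
Fin-cast ≡.refl = Identity.inverse _

Fin×Fin-inverse : ∀ {m n} → Inverse (≡.setoid (Fin m) ×ₛ ≡.setoid (Fin n)) (≡.setoid (Fin (m * n)))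
Fin×Fin-inverse = Pointwise-≡↔≡ ⨾ Symmetry.inverse *↔×

×-cardinality : ∀ {a b ℓ₁ ℓ₂} {A : Setoid a ℓ₁} {B : Setoid b ℓ₂} {m n} →
                Inverse A (≡.setoid (Fin m)) → Inverse B (≡.setoid (Fin n)) → Inverse (A ×ₛ B) (≡.setoid (Fin (m * n)))
×-cardinality f g = (f ×-inverse g) ⨾ Fin×Fin-inverse

C₂-suc : ∀ n → suc n C 2 ≡ n + n C 2
C₂-suc n = ≡.trans (≡.sym (nCk+nC[k+1]≡[n+1]C[k+1] n 1)) (≡.cong (_+ n C 2) (nC1≡n n))

C₂*2 : ∀ n → (n C 2) * 2 ≡ n * (n ∸ 1)
C₂*2 zero          = ≡.refl
C₂*2 (suc zero)    = ≡.refl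
C₂*2 (suc (suc n)) = begin
  (suc (suc n) C 2) * 2        ≡⟨ ≡.cong (_* 2) (C₂-suc (suc n)) ⟩
  (suc n + suc n C 2) * 2      ≡⟨ *-distribʳ-+ 2 (suc n) (suc n C 2) ⟩
  suc n * 2 + (suc n C 2) * 2  ≡⟨ ≡.cong (suc n * 2 +_) (C₂*2 (suc n)) ⟩
  suc n * 2 + suc n * n        ≡⟨ *-distribˡ-+ (suc n) 2 n ⟨
  suc n * suc (suc n)          ≡⟨ *-comm (suc n) (suc (suc n)) ⟩
  suc (suc n) * suc n          ∎
  where open ≡.≡-Reasoning

*C₂≡*n*[n∸1]/2 : ∀ k n → k * (n C 2) ≡ (k * n * (n ∸ 1)) / 2
*C₂≡*n*[n∸1]/2 k n = begin
  k * (n C 2)                 ≡⟨ m*n/n≡m (k * (n C 2)) 2 ⟨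
  (k * (n C 2) * 2) / 2       ≡⟨ ≡.cong (_/ 2) (*-assoc k (n C 2) 2) ⟩
  (k * ((n C 2) * 2)) / 2     ≡⟨ ≡.cong (λ x → (k * x) / 2) (C₂*2 n) ⟩
  (k * (n * (n ∸ 1))) / 2     ≡⟨ ≡.cong (_/ 2) (*-assoc k n (n ∸ 1)) ⟨
  (k * n * (n ∸ 1)) / 2       ∎
  where open ≡.≡-Reasoning

module _ {c ℓ} (F : Field c ℓ) where
  open Field F using (Carrier; _≈_; setoid; refl; sym; trans)

  AntipodalHamming-Adj-cong : ∀ {n} {u u′ v v′ : Fin n → Carrier} →
    Setoid._≈_ (vecSetoid F n) u u′ → Setoid._≈_ (vecSetoid F n) v v′ →
    Adj (AntipodalHamming F n) u v ⇔ Adj (AntipodalHamming F n) u′ v′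
  AntipodalHamming-Adj-cong u≈u′ v≈v′ = mk⇔
    (λ apart i u′ᵢ≈v′ᵢ → apart i (trans (u≈u′ i) (trans u′ᵢ≈v′ᵢ (sym (v≈v′ i)))))
    (λ apart i uᵢ≈vᵢ → apart i (trans (sym (u≈u′ i)) (trans uᵢ≈vᵢ (v≈v′ i))))

  vec-uncons : ∀ n → Inverse (vecSetoid F (suc n)) (setoid ×ₛ vecSetoid F n)
  vec-uncons n = mkInverse
    (λ v → v fzero , v ∘ fsuc)
    (λ (x , v) → x ∷ v)
    (λ v≈w → v≈w fzero , v≈w ∘ fsuc)
    (λ { (x≈y , v≈w) fzero → x≈y ; (x≈y , v≈w) (fsuc i) → v≈w i })
    (λ _ → refl , λ _ → refl)
    (λ { v fzero → refl ; v (fsuc i) → refl })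

  T-uncons : ∀ n → Inverse (TSetoid F (suc n)) (setoid ×ₛ (vecSetoid F n ×ₛ TSetoid F n))
  T-uncons n = mkInverse
    (λ (A , A-upper) → A fzero fzero , row F A , sub F A , sub-upper F A-upper)
    (λ (a , r , A , A-upper) → block F a r A , block-upper F a r A-upper)
    (λ A≋B → A≋B fzero fzero , (λ j → A≋B fzero (fsuc j)) , λ i j → A≋B (fsuc i) (fsuc j))
    (λ { (a≈b , r≈s , A≋B) fzero    fzero    → a≈b
       ; (a≈b , r≈s , A≋B) fzero    (fsuc j) → r≈s j
       ; (a≈b , r≈s , A≋B) (fsuc i) fzero    → refl
       ; (a≈b , r≈s , A≋B) (fsuc i) (fsuc j) → A≋B i j })
    (λ _ → refl , (λ _ → refl) , λ _ _ → refl)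
    (λ { (A , A-upper) fzero    fzero    → refl
       ; (A , A-upper) fzero    (fsuc j) → refl
       ; (A , A-upper) (fsuc i) fzero    → sym (A-upper (fsuc i) fzero (s≤s z≤n))
       ; (A , A-upper) (fsuc i) (fsuc j) → refl })

  module _ {q} (card : HasCardinality F q) where

    vec-cardinality : ∀ n → Inverse (vecSetoid F n) (≡.setoid (Fin (q ^ n)))
    vec-cardinality zero    = mkInverse (λ _ → fzero) (λ _ ()) (λ _ → ≡.refl) (λ _ ()) (λ { fzero → ≡.refl }) (λ _ ())
    vec-cardinality (suc n) = vec-uncons n ⨾ ×-cardinality card (vec-cardinality n)

    -- The first component encodes the n C 2 entries strictly above the diagonal.
    T-cardinality : ∀ n → Inverse (TSetoid F n) (≡.setoid (Fin (q ^ (n C 2))) ×ₛ vecSetoid F n)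
    T-cardinality zero    = mkInverse (λ _ → fzero , λ ()) (λ _ → (λ ()) , λ ())
      (λ _ → ≡.refl , λ ()) (λ _ ()) (λ { (fzero , _) → ≡.refl , λ () }) (λ _ ())
    T-cardinality (suc n) =
      T-uncons n ⨾
      Identity.inverse setoid ×-inverse (vec-cardinality n ×-inverse T-cardinality n) ⨾
      ×-shuffle ⨾
      (Fin×Fin-inverse ⨾ Fin-cast strictUpper-count) ×-inverse Symmetry.inverse (vec-uncons n)
      where
        strictUpper-count : q ^ n * q ^ (n C 2) ≡ q ^ (suc n C 2)
        strictUpper-count = ≡.trans (≡.sym (^-distribˡ-+-* q n (n C 2))) (≡.cong (q ^_) (≡.sym (C₂-suc n)))

    T-cardinality-diagonal : ∀ n (x : T F n) i → proj₂ (Inverse.to (T-cardinality n) x) i ≈ diagonal F x i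
    T-cardinality-diagonal (suc n) x fzero    = refl
    T-cardinality-diagonal (suc n) (A , A-upper) (fsuc i) =
      T-cardinality-diagonal n (sub F A , sub-upper F A-upper) i

module _ {c ℓ e} {H : Graph c ℓ e} {m : ℕ} where

  K•-Adj⇔ : ∀ {u u′ : Fin m} {v v′} → Adj (K m • H) (u , v) (u′ , v′) ⇔ Adj H v v′
  K•-Adj⇔ {u} {u′} = mk⇔ (λ { (inj₁ (_ , v~v′)) → v~v′ ; (inj₂ (_ , v~v′)) → v~v′ }) (tag (u Fin.≟ u′))
    where
      tag : ∀ {v v′} → Dec (u ≡ u′) → Adj H v v′ → Adj (K m • H) (u , v) (u′ , v′)
      tag (yes u≡u′) v~v′ = inj₂ (u≡u′ , v~v′)
      tag (no  u≢u′) v~v′ = inj₁ (u≢u′ , v~v′)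

  ≃-K• : ∀ {c′ ℓ′ e′} {G : Graph c′ ℓ′ e′} (f : Inverse (V G) (≡.setoid (Fin m) ×ₛ V H)) →
         (∀ x y → Adj G x y ⇔ Adj H (proj₂ (Inverse.to f x)) (proj₂ (Inverse.to f y))) →
         G ≃ (K m • H)
  ≃-K• f G~⇔H~ = f , λ x y → Symmetry.⇔-sym K•-Adj⇔ ⇔-∘ G~⇔H~ x y

UnitaryCayleyT≃K•AntipodalHamming : ∀ {c ℓ} (F : Field c ℓ) {q} → HasCardinality F q → ∀ n →
  UnitaryCayleyT F (suc n) ≃ (K (q ^ (suc n C 2)) • AntipodalHamming F (suc n))
UnitaryCayleyT≃K•AntipodalHamming F card n =
  ≃-K• {H = AntipodalHamming F (suc n)} (T-cardinality F card (suc n)) λ x y →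
    AntipodalHamming-Adj-cong F (sym (T-cardinality-diagonal F card (suc n) x))
                                (sym (T-cardinality-diagonal F card (suc n) y))
    ⇔-∘ UnitaryCayleyT-Adj⇔ F x y
  where open Setoid (vecSetoid F (suc n)) using (sym)

theorem2 : ∀ {c ℓ} (F : Field c ℓ) (p k n : ℕ) → Prime p → 1 ≤ k →
    HasCardinality F (p ^ k) → 2 < p ^ k → 2 ≤ n →
    UnitaryCayleyT F n ≃ (K (p ^ ((k * n * (n ∸ 1)) / 2)) • AntipodalHamming F n)
theorem2 F p k zero    _ _ _    _ ()
theorem2 F p k (suc n) _ _ card _ _ =
  ≡.subst (λ m → UnitaryCayleyT F (suc n) ≃ (K m • AntipodalHamming F (suc n)))
          (≡.trans (^-*-assoc p k (suc n C 2)) (≡.cong (p ^_) (*C₂≡*n*[n∸1]/2 k (suc n))))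
          (UnitaryCayleyT≃K•AntipodalHamming F card n)
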